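{- Let $\mathcal{G}=(V,\sigma,E)$ be a signed, colored graph of type $(n,N)$ satisfying axioms (ax1), (ax2), (ax3), (ax5), and let $1<i<n$. If every connected component of $(V,E_{i-2}\cup E_{i-1})$ is (as an edge-coloured graph) a single vertex, a path $p$–$q$–$r$ with $\{p,q\}\in E_{i-2}$ and $\{q,r\}\in E_{i-1}$, or two vertices $p,q$ with $\{p,q\}\in E_{i-2}\cap E_{i-1}$, then $W_i^0(\mathcal{G})=W_i(\mathcal{G})$.
   Context: A signed, colored graph of type $(n,N)$ is $(V,\sigma,E_2\cup\cdots\cup E_{n-1})$ with $V$ finite, $\sigma:V\to\{\pm1\}^{N-1}$ ($\sigma(v)_j$ the $j$-th entry) and for $1<i<n$ a set $E_i$ of $2$-element subsets of $V$; $E_j$ is empty for other $j$. If $w$ lies in a unique $i$-edge $\{w,x\}$, write $x=E_i(w)$ and say $w$ has an $i$-neighbour. Axioms: (ax1) $\sigma(w)_{i-1}=-\sigma(w)_i$ iff $w$ lies in some $i$-edge, and then in a unique one. (ax2) if $\{w,x\}\in E_i$ then $\sigma(w)_j=-\sigma(x)_j$ for $j=i-1,i$ and $\sigma(w)_h=\sigma(x)_h$ for $h<i-2$, $h>i+1$. (ax3) if $\{w,x\}\in E_i$ and $\sigma(w)_{i-2}=-\sigma(x)_{i-2}$ then $\sigma(w)_{i-2}=-\sigma(w)_{i-1}$; if $\sigma(w)_{i+1}=-\sigma(x)_{i+1}$ then $\sigma(w)_{i+1}=-\sigma(w)_i$. (ax5) if $\{w,x\}\in E_i$, $\{x,y\}\in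 E_j$, $|i-j|\ge3$, there is $v$ with $\{w,v\}\in E_j$, $\{v,y\}\in E_i$. A vertex $w$ has $i$-type W if $w$ has an $(i-1)$-neighbour and $\sigma(w)_i=-\sigma(E_{i-1}(w))_i$. A vertex $w$ has a flat $i$-edge if it has an $i$-neighbour and $\sigma(w)_{i-2}=\sigma(E_i(w))_{i-2}$. A non-flat $i$-chain is a sequence $(w_1,\dots,w_{2h})$ of distinct vertices with $w_{2j-1}=E_i(w_{2j})$ for $1\le j\le h$ and $w_{2j+1}=E_{i-1}(w_{2j})$ for $1\le j<h$. $W_i(\mathcal{G})$ is the set of vertices $w$ with $w=w_j$ for some non-flat $i$-chain $(w_1,\dots,w_{2h})$ and some $1<j<2h$. The $k$-package of $w$ is the connected component containing $w$ of $(V,E_2\cup\cdots\cup E_{k-3}\cup E_{k+3}\cup\cdots\cup E_{n-1})$. $W_i^0(\mathcal{G})$ is the set of $w\in W_i(\mathcal{G})$ such that every vertex of the $(i-1)$-package of $w$ has a flat $(i-1)$-edge. -}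

module Defs where

open import Data.Nat using (ℕ; zero; suc; _+_; _*_; _∸_; _≤_; _<_)
open import Data.Nat.Properties using (_<?_)
open import Data.Fin using (Fin; fromℕ<)
open import Data.Sign using (Sign; opposite) renaming (+ to plus)
open import Data.Product using (Σ; ∃; _×_; _,_)
open import Data.Sum using (_⊎_)
open import Relation.Nullary using (¬_; yes; no)
open import Relation.Binary.PropositionalEquality using (_≡_; _≢_)
open import Relation.Binary.Construct.Closure.ReflexiveTransitive using (Star)
open import Function.Bundles using (_⇔_)

-- A signed, colored graph of type (n,N) with vertex set V = Fin m.
-- σ w : Fin (N ∸ 1) → Sign; position k encodes the (k+1)-th entry σ(w)_{k+1}.
record SCGraph (n N : ℕ) : Set₁ where
  field
    m     : ℕ
    σ     : Fin m → Fin (N ∸ 1) → Sign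
    E     : ℕ → Fin m → Fin m → Set
    E-sym : ∀ {i w x} → E i w x → E i x w
    E-irr : ∀ {i w} → ¬ E i w w
    E-rng : ∀ {i w x} → E i w x → 1 < i × i < n

-- Extension of a sign vector to all indices j ∈ ℕ (1-based):
-- entries with j outside 1..N-1 are set to the constant +1.
extSign : ∀ {k} → (Fin k → Sign) → ℕ → Sign
extSign f zero = plus
extSign {k} f (suc j) with j <? k
... | yes p = f (fromℕ< p)
... | no _  = plus

module _ {n N : ℕ} (G : SCGraph n N) where
  open SCGraph G

  V : Set
  V = Fin m

  sg : V → ℕ → Sign
  sg w = extSign (σ w)

  Ax1 : Set
  Ax1 = ∀ i → 1 < i → i < n → ∀ w →
          (sg w (i ∸ 1) ≡ opposite (sg w i) ⇔ ∃ λ x → E i w x)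
          × (∀ x y → E i w x → E i w y → x ≡ y)

  Ax2 : Set
  Ax2 = ∀ i w x → E i w x →
          (sg w (i ∸ 1) ≡ opposite (sg x (i ∸ 1)))
          × (sg w i ≡ opposite (sg x i))
          × (∀ h → (h + 2 < i ⊎ i + 1 < h) → sg w h ≡ sg x h)

  Ax3 : Set
  Ax3 = ∀ i w x → E i w x →
          (sg w (i ∸ 2) ≡ opposite (sg x (i ∸ 2)) → sg w (i ∸ 2) ≡ opposite (sg w (i ∸ 1)))
          × (sg w (i + 1) ≡ opposite (sg x (i + 1)) → sg w (i + 1) ≡ opposite (sg w i))

  Ax5 : Set
  Ax5 = ∀ i j w x y → E i w x → E j x y → (i + 3 ≤ j ⊎ j + 3 ≤ i) →
          ∃ λ v → E j w v × E i v y

  HasFlat : ℕ → V → Set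
  HasFlat i w = ∃ λ x → E i w x × sg w (i ∸ 2) ≡ sg x (i ∸ 2)

  -- A non-flat i-chain (w_1,…,w_{2h}), h ≥ 1, encoded 0-based as c 0 … c (2h-1).
  record Chain (i : ℕ) : Set where
    field
      h     : ℕ
      h≥1   : 1 ≤ h
      c     : ℕ → V
      inj   : ∀ a b → a < 2 * h → b < 2 * h → c a ≡ c b → a ≡ b
      iEdge : ∀ j → j < h → E i (c (2 * j + 1)) (c (2 * j))
      i-1Edge : ∀ j → suc j < h → E (i ∸ 1) (c (2 * j + 1)) (c (2 * j + 2))

  -- W_i(G): interior vertices of non-flat i-chains (1 < j < 2h, i.e. 0-based 1 ≤ k ≤ 2h-2)
  W : ℕ → V → Set
  W i w = Σ (Chain i) λ ch → let open Chain ch in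
            ∃ λ k → 1 ≤ k × suc k < 2 * h × c k ≡ w

  PkgEdge : ℕ → V → V → Set
  PkgEdge k a b = ∃ λ col → (col + 3 ≤ k ⊎ k + 3 ≤ col) × E col a b

  InPackage : ℕ → V → V → Set
  InPackage k w v = Star (PkgEdge k) w v

  W0 : ℕ → V → Set
  W0 i w = W i w × (∀ v → InPackage (i ∸ 1) w v → HasFlat (i ∸ 1) v)

  CompEdge : ℕ → V → V → Set
  CompEdge i a b = E (i ∸ 2) a b ⊎ E (i ∸ 1) a b

  Comp : ℕ → V → V → Set
  Comp i w v = Star (CompEdge i) w v

  SingleComp : ℕ → V → Set
  SingleComp i w = ∀ v → Comp i w v → v ≡ w

  PathComp : ℕ → V → Set
  PathComp i w = ∃ λ p → ∃ λ q → ∃ λ r →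
    p ≢ q × q ≢ r × p ≢ r
    × (∀ v → Comp i w v ⇔ (v ≡ p ⊎ v ≡ q ⊎ v ≡ r))
    × (∀ a b → Comp i w a →
         (E (i ∸ 2) a b ⇔ ((a ≡ p × b ≡ q) ⊎ (a ≡ q × b ≡ p)))
       × (E (i ∸ 1) a b ⇔ ((a ≡ q × b ≡ r) ⊎ (a ≡ r × b ≡ q))))

  DoubleComp : ℕ → V → Set
  DoubleComp i w = ∃ λ p → ∃ λ q →
    p ≢ q
    × (∀ v → Comp i w v ⇔ (v ≡ p ⊎ v ≡ q))
    × (∀ a b → Comp i w a →
         (E (i ∸ 2) a b ⇔ ((a ≡ p × b ≡ q) ⊎ (a ≡ q × b ≡ p)))
       × (E (i ∸ 1) a b ⇔ ((a ≡ p × b ≡ q) ⊎ (a ≡ q × b ≡ p))))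

module Submission where

-- Only W_i ⊆ W⁰_i needs proof.  Call a vertex z (i-1)-two-sided when it has
-- an (i-1)-neighbour u such that z and u both have i-neighbours; every
-- interior vertex of a non-flat i-chain is two-sided.  The argument:
--   1. (local) the (i-1)-edge of a two-sided vertex is flat: by the shape of
--      its component it cannot lie in a point or a doubled edge (the latter
--      gives a sign clash via ax1/ax2), and in a path a non-flat edge would
--      force its endpoint r to have an (i-2)-neighbour (ax3 + ax1).
--   2. (transport, general colour j) using ax5, edges of low colour c ≤ j-3
--      preserve two-sidedness and commute past edges of high colour ≥ j+3,
--      so every vertex of the j-package of a two-sided vertex is reached from
--      some two-sided vertex by high edges only; high edges preserve having
--      a flat j-edge (ax5 + ax2).
-- Combining both with j = i-1 shows that the whole (i-1)-package of any
-- w ∈ W_i consists of vertices with a flat (i-1)-edge.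

open import Defs
open import Data.Nat using (ℕ; zero; suc; _+_; _*_; _∸_; _≤_; _<_; s≤s; z≤n)
open import Data.Nat.Properties
  using (≤-trans; <-trans; n≤1+n; ≤-<-trans; <-≤-trans; ≤-refl; ≤-reflexive; n<1+n; m≤m+n;
         m∸n≤m; +-monoˡ-≤; +-monoʳ-<; +-comm; +-suc; *-suc; *-cancelˡ-<)
open import Data.Sign using (Sign; opposite) renaming (+ to plus; - to minus)
open import Data.Sign.Properties using (s≢opposite[s]) renaming (_≟_ to _≟ˢ_)
open import Data.Product using (∃; _×_; _,_; proj₁; proj₂)
open import Data.Sum using (_⊎_; inj₁; inj₂)
open import Data.Empty using (⊥; ⊥-elim)
open import Relation.Nullary using (¬_; yes; no)
open import Relation.Binary.PropositionalEquality
  using (_≡_; _≢_; refl; sym; trans; cong; subst; module ≡-Reasoning)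
open import Relation.Binary.Construct.Closure.ReflexiveTransitive using (Star; ε; _◅_; _◅◅_)
open import Function.Bundles using (_⇔_; mk⇔; Equivalence)
open Equivalence using (to; from)

≢⇒opposite : ∀ {a b : Sign} → a ≢ b → a ≡ opposite b
≢⇒opposite {minus} {minus} a≢b = ⊥-elim (a≢b refl)
≢⇒opposite {minus} {plus}  _   = refl
≢⇒opposite {plus}  {minus} _   = refl
≢⇒opposite {plus}  {plus}  a≢b = ⊥-elim (a≢b refl)

data ParityView : ℕ → Set where
  even : ∀ j → ParityView (2 * j)
  odd  : ∀ j → ParityView (2 * j + 1)

2*suc : ∀ j → 2 * suc j ≡ 2 * j + 2
2*suc j = trans (*-suc 2 j) (+-comm 2 (2 * j))

parityView : ∀ m → ParityView m
parityView zero = even 0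
parityView (suc m) with parityView m
... | even j = subst ParityView (+-comm (2 * j) 1) (odd j)
... | odd j  = subst ParityView (trans (2*suc j) (+-suc (2 * j) 1)) (even (suc j))

-- If j + 3 ≤ d then the sign position j - 2 is left untouched by d-edges (ax2).
below-by-three : ∀ j d → j + 3 ≤ d → j ∸ 2 + 2 < d
below-by-three j d j+3≤d =
  ≤-<-trans (+-monoˡ-≤ 2 (m∸n≤m j 2)) (<-≤-trans (+-monoʳ-< j ≤-refl) j+3≤d)

module Axioms {n N : ℕ} (G : SCGraph n N)
              (ax1 : Ax1 G) (ax2 : Ax2 G) (ax3 : Ax3 G) (ax5 : Ax5 G) where
  open SCGraph G

  HasNbr : ℕ → V G → Set
  HasNbr d z = ∃ λ t → E d z t

  Rung : ℕ → V G → V G → Set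
  Rung j z u = E j z u × HasNbr (suc j) z × HasNbr (suc j) u

  rung-sym : ∀ {j z u} → Rung j z u → Rung j u z
  rung-sym (e , nz , nu) = E-sym e , nu , nz

  TwoSided : ℕ → V G → Set
  TwoSided j z = ∃ (Rung j z)

  -- Every interior vertex of a non-flat (j+1)-chain lies on a rung of colour j:
  -- each j-edge c(2l+1) – c(2l+2) of the chain (0-based) is a rung, its ends
  -- having the i-neighbours c(2l) and c(2l+3).
  chain⇒twoSided : ∀ {j w} → W G (suc j) w → TwoSided j w
  chain⇒twoSided {j} (ch , pos , 1≤pos , pos<2h , c≡w) =
    subst (TwoSided j) c≡w (interior pos 1≤pos pos<2h (parityView pos))
    where
    open Chain ch

    rung : ∀ l → suc l < h → Rung j (c (2 * l + 1)) (c (2 * l + 2))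
    rung l l+1<h =
        i-1Edge l l+1<h
      , (c (2 * l) , iEdge l (<-trans (n<1+n l) l+1<h))
      , (c (2 * suc l + 1) , subst (λ m → E (suc j) (c m) (c (2 * suc l + 1)))
                                   (2*suc l) (E-sym (iEdge (suc l) l+1<h)))

    interior : ∀ pos → 1 ≤ pos → suc pos < 2 * h → ParityView pos → TwoSided j (c pos)
    interior .(2 * suc l) _ pos<2h (even (suc l)) =
      subst (λ m → TwoSided j (c m)) (sym (2*suc l))
        (_ , rung-sym (rung l (*-cancelˡ-< 2 (suc l) h (<-trans (n<1+n _) pos<2h))))
    interior .(2 * l + 1) _ pos<2h (odd l) =
      _ , rung l (*-cancelˡ-< 2 (suc l) h
                   (subst (λ m → suc m ≤ 2 * h) (sym (trans (2*suc l) (+-suc (2 * l) 1))) pos<2h))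

  -- Two vertices joined by both a k-edge and a (k+1)-edge cannot both have
  -- (k+2)-neighbours: ax1 ties σ_{k+1} to σ_{k+2} at both ends, ax2 makes the
  -- k-edge keep σ_{k+2} but the (k+1)-edge flip σ_{k+1}.
  doubled-edge-clash : ∀ {k z u} → suc (suc k) < n →
    E k z u → Rung (suc k) z u → ⊥
  doubled-edge-clash {k} {z} {u} k+2<n e-low (e-high , nz , nu) =
    s≢opposite[s] (sg G u (suc k)) (trans (sym same) (proj₁ (proj₂ (ax2 (suc k) z u e-high))))
    where
    open ≡-Reasoning
    high-sign : ∀ {v} → HasNbr (suc (suc k)) v → sg G v (suc k) ≡ opposite (sg G v (suc (suc k)))
    high-sign {v} nv = from (proj₁ (ax1 (suc (suc k)) (s≤s (s≤s z≤n)) k+2<n v)) nv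
    same : sg G z (suc k) ≡ sg G u (suc k)
    same = begin
      sg G z (suc k)                  ≡⟨ high-sign nz ⟩
      opposite (sg G z (suc (suc k))) ≡⟨ cong opposite (proj₂ (proj₂ (ax2 k z u e-low)) (suc (suc k))
                                           (inj₂ (s≤s (≤-reflexive (+-comm k 1))))) ⟩
      opposite (sg G u (suc (suc k))) ≡⟨ sym (high-sign nu) ⟩
      sg G u (suc k)                  ∎

  -- An endpoint of a non-flat (k+1)-edge has a k-neighbour (ax3, then ax1).
  nonflat⇒lowerNbr : ∀ {k y y'} → 1 < k → k < n → E (suc k) y y' →
    sg G y (k ∸ 1) ≢ sg G y' (k ∸ 1) → HasNbr k y
  nonflat⇒lowerNbr {k} {y} {y'} 1<k k<n e nonflat =
    to (proj₁ (ax1 k 1<k k<n y)) (proj₁ (ax3 (suc k) y y' e) (≢⇒opposite nonflat))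

  ComponentShapes : ℕ → Set
  ComponentShapes i = ∀ w → SingleComp G i w ⊎ PathComp G i w ⊎ DoubleComp G i w

  -- In a path component p –(i-2)– q –(i-1)– r every (i-1)-edge is flat: it is
  -- the edge q–r, and if it were not flat r would have an (i-2)-neighbour.
  path-edge-flat : ∀ {k z u} → suc (suc k) < n → PathComp G (suc (suc k)) z →
    E (suc k) z u → sg G z (k ∸ 1) ≡ sg G u (k ∸ 1)
  path-edge-flat {k} {z} {u} i<n (p , q , r , _ , q≢r , p≢r , members , edges) e
    with sg G z (k ∸ 1) ≟ˢ sg G u (k ∸ 1)
  ... | yes flat = flat
  ... | no nonflat = endpoint-r (to (proj₂ (edges z u ε)) e)
    where
    1<k : 1 < k
    1<k = proj₁ (E-rng (from (proj₁ (edges p q (from (members p) (inj₁ refl)))) (inj₁ (refl , refl))))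

    k<n : k < n
    k<n = <-trans (n<1+n k) (<-trans (n<1+n (suc k)) i<n)

    r-isolated : ∀ {y} → Comp G (suc (suc k)) z y → y ≡ r → ¬ HasNbr k y
    r-isolated z~y refl (x , e-yx) with to (proj₁ (edges _ x z~y)) e-yx
    ... | inj₁ (r≡p , _) = p≢r (sym r≡p)
    ... | inj₂ (r≡q , _) = q≢r (sym r≡q)

    endpoint-r : (z ≡ q × u ≡ r) ⊎ (z ≡ r × u ≡ q) → sg G z (k ∸ 1) ≡ sg G u (k ∸ 1)
    endpoint-r (inj₁ (_ , u≡r)) = ⊥-elim
      (r-isolated (inj₂ e ◅ ε) u≡r (nonflat⇒lowerNbr 1<k k<n (E-sym e) (λ eq → nonflat (sym eq))))
    endpoint-r (inj₂ (z≡r , _)) = ⊥-elim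
      (r-isolated ε z≡r (nonflat⇒lowerNbr 1<k k<n e nonflat))

  -- Step 1: under the component hypothesis for colour i = k+2, every rung of
  -- colour i-1 is flat (a point carries no edge, a doubled edge carries no rung).
  rung-flat : ∀ {k} → suc (suc k) < n → ComponentShapes (suc (suc k)) →
    ∀ {z u} → Rung (suc k) z u → sg G z (k ∸ 1) ≡ sg G u (k ∸ 1)
  rung-flat {k} i<n shapes {z} {u} rung@(e , _) with shapes z
  ... | inj₁ single = ⊥-elim (E-irr (subst (E (suc k) z) (single u (inj₂ e ◅ ε)) e))
  ... | inj₂ (inj₁ path) = path-edge-flat i<n path e
  ... | inj₂ (inj₂ (_ , _ , _ , _ , edges)) =
    ⊥-elim (doubled-edge-clash i<n (from (proj₁ (edges z u ε)) (to (proj₂ (edges z u ε)) e)) rung)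

  HighEdge : ℕ → V G → V G → Set
  HighEdge j a b = ∃ λ d → j + 3 ≤ d × E d a b

  nbr-along-low : ∀ {c d z z'} → c + 3 ≤ d → E c z' z → HasNbr d z → HasNbr d z'
  nbr-along-low {c} {d} {z} {z'} c+3≤d e-z'z (t , e-zt) with ax5 c d z' z t e-z'z e-zt (inj₁ c+3≤d)
  ... | t' , e-z't' , _ = t' , e-z't'

  twoSided-along-low : ∀ {c j z z'} → c + 3 ≤ j → E c z z' → TwoSided j z → TwoSided j z'
  twoSided-along-low {c} {j} {z} {z'} c+3≤j e-zz' (u , e-zu , nz , nu)
    with ax5 c j z' z u (E-sym e-zz') e-zu (inj₁ c+3≤j)
  ... | u' , e-z'u' , e-u'u =
    u' , e-z'u' , nbr-along-low c+3≤j+1 (E-sym e-zz') nz , nbr-along-low c+3≤j+1 e-u'u nu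
    where
    c+3≤j+1 : c + 3 ≤ suc j
    c+3≤j+1 = ≤-trans c+3≤j (n≤1+n j)

  low-past-high : ∀ {c j z v v'} → c + 3 ≤ j → Star (HighEdge j) z v → E c v v' →
    ∃ λ z' → E c z z' × Star (HighEdge j) z' v'
  low-past-high c+3≤j ε e = _ , e , ε
  low-past-high {c} {j} {z} c+3≤j ((d , j+3≤d , e-zy) ◅ path) e
    with low-past-high c+3≤j path e
  ... | y' , e-yy' , path'
    with ax5 d c z _ y' e-zy e-yy' (inj₂ (≤-trans c+3≤j (≤-trans (m≤m+n j 3) j+3≤d)))
  ... | z' , e-zz' , e-z'y' = z' , e-zz' , ((d , j+3≤d , e-z'y') ◅ path')

  flat-along-high : ∀ {j v v'} → HighEdge j v v' → HasFlat G j v → HasFlat G j v'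
  flat-along-high {j} {v} {v'} (d , j+3≤d , e-vv') (x , e-vx , flat)
    with ax5 d j v' v x (E-sym e-vv') e-vx (inj₂ j+3≤d)
  ... | x' , e-v'x' , e-x'x = x' , e-v'x' , (begin
      sg G v' (j ∸ 2) ≡⟨ sym (keeps e-vv') ⟩
      sg G v (j ∸ 2)  ≡⟨ flat ⟩
      sg G x (j ∸ 2)  ≡⟨ sym (keeps e-x'x) ⟩
      sg G x' (j ∸ 2) ∎)
    where
    open ≡-Reasoning
    keeps : ∀ {a b} → E d a b → sg G a (j ∸ 2) ≡ sg G b (j ∸ 2)
    keeps {a} {b} e = proj₂ (proj₂ (ax2 d a b e)) (j ∸ 2) (inj₁ (below-by-three j d j+3≤d))

  flat-along-highPath : ∀ {j v v'} → Star (HighEdge j) v v' → HasFlat G j v → HasFlat G j v'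
  flat-along-highPath ε flat = flat
  flat-along-highPath (e ◅ path) flat = flat-along-highPath path (flat-along-high e flat)

  Reachable : ℕ → V G → Set
  Reachable j v = ∃ λ z → TwoSided j z × Star (HighEdge j) z v

  -- Reachability is closed under package edges: high edges extend the path,
  -- low edges are commuted to its start, where they preserve two-sidedness.
  reachable-step : ∀ {j a b} → Reachable j a → PkgEdge G j a b → Reachable j b
  reachable-step (z , tz , path) (d , inj₂ j+3≤d , e) = z , tz , (path ◅◅ ((d , j+3≤d , e) ◅ ε))
  reachable-step (z , tz , path) (d , inj₁ d+3≤j , e) with low-past-high d+3≤j path e
  ... | z' , e-zz' , path' = z' , twoSided-along-low d+3≤j e-zz' tz , path'

  package-reachable : ∀ {j w v} → TwoSided j w → InPackage G j w v → Reachable j v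
  package-reachable tw = go (_ , tw , ε)
    where
    go : ∀ {j a b} → Reachable j a → Star (PkgEdge G j) a b → Reachable j b
    go ra ε = ra
    go ra (e ◅ path) = go (reachable-step ra e) path

  reachable-flat : ∀ {j} → (∀ {z u} → Rung j z u → sg G z (j ∸ 2) ≡ sg G u (j ∸ 2)) →
    ∀ {v} → Reachable j v → HasFlat G j v
  reachable-flat rungs-flat (_ , (u , r@(e , _)) , path) = flat-along-highPath path (u , e , rungs-flat r)

proposition5p9 : ∀ {n N : ℕ} (G : SCGraph n N) →
    Ax1 G → Ax2 G → Ax3 G → Ax5 G →
    ∀ (i : ℕ) → 1 < i → i < n →
    (∀ w → SingleComp G i w ⊎ PathComp G i w ⊎ DoubleComp G i w) →
    ∀ w → W0 G i w ⇔ W G i w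
proposition5p9 G ax1 ax2 ax3 ax5 (suc (suc k)) (s≤s (s≤s z≤n)) i<n shapes w =
  mk⇔ proj₁ λ w∈W → w∈W , λ v w~v →
    reachable-flat (rung-flat i<n shapes) (package-reachable (chain⇒twoSided w∈W) w~v)
  where open Axioms G ax1 ax2 ax3 ax5
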